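{- For every Young board $\lambda$, the map $\zeta_\lambda:\mathcal{S}_\lambda\to\mathcal{S}_\lambda$ is a bijection.
   Context: A Young board $\lambda=(\lambda_1,\dots,\lambda_n)$ with $\lambda_1\ge\dots\ge\lambda_n>0$ is the cell set $\{(i,j):1\le i\le n,\ 1\le j\le\lambda_i\}$, with width $n$ and height $\lambda_1$. A filling is a $0/1$ assignment to the cells with at most one $1$ per row and per column. It is encoded by the word $\pi_1\cdots\pi_n$ with $\pi_c=r$ if $(c,r)$ holds a $1$ and $\pi_c=\square$ if column $c$ is empty. $\mathcal{S}_\lambda$ is the set of standard fillings: those with exactly one $1$ in every row and column of $\lambda$. Such a filling is a permutation word with $\pi_i\le\lambda_i$. For a filling $\pi$ of $\mu$ with no empty columns and empty row set $R$, let $\rho_\mu^{\emptyset,R}(\pi)$ be the standard filling of the board $\mu^{(\emptyset,R)}$ (delete the rows in $R$) obtained by deleting the empty rows. Its word is the reduction of $\pi$. Recursive definition of $\zeta_\lambda$: - If $\lambda$ has width $0$ or $1$, $\zeta_\lambda$ is the identity. - Otherwise, for $\pi\in\mathcal{S}_\lambda$ of width $n$, let $j$ be the index with $\pi_j=1$, and define $\pi^*=\zeta_\lambda(\pi)$ as follows. - Set $\pi^*_j=\lambda_j$. - Set $\pi^*_i=\pi_i-1$ for $i>j$. - Let $\mu=(\lambda_1,\dots,\lambda_{j-1})$, $h=\pi_1\cdots\pi_{j-1}$ (a filling of $\mu$ with empty rows $R=\{\pi_j,\dots,\pi_n\}$), and $\mu'=\mu^{(\emptyset,R)}$. - Let $h'=\rho_\mu^{\emptyset,R}(h)$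 and $h^*=\zeta_{\mu'}(h')$. - With $R'=\{\lambda_j,\pi_{j+1}-1,\dots,\pi_n-1\}$, note $\mu^{(\emptyset,R')}=\mu'$. Set $\pi^*_1\cdots\pi^*_{j-1}=(\rho_\mu^{\emptyset,R'})^{ -1}(h^*)$, i.e. the unique filling of $\mu$ with empty rows exactly $R'$ and no empty columns whose row-deletion gives $h^*$. -}

module Defs where

open import Data.Nat using (ℕ; zero; suc; _∸_; _+_; _≤_; _<_; _≥_; _≤?_; _<?_; _≟_)
open import Data.List using (List; []; _∷_; length; filter; map; upTo; take; drop; _++_)
open import Data.List.Relation.Unary.All using (All)
open import Data.List.Relation.Unary.Linked using (Linked)
open import Data.List.Relation.Unary.Unique.Propositional using (Unique)
open import Data.List.Relation.Binary.Pointwise using (Pointwise)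
open import Data.List.Membership.Propositional using (_∈_)
open import Data.List.Membership.DecPropositional _≟_ using (_∈?_)
open import Data.Product using (_×_; _,_; proj₁; proj₂)
open import Relation.Nullary using (¬?)

-- A Young board λ = (λ₁,…,λₙ), given as the list of column heights,
-- with λ₁ ≥ … ≥ λₙ > 0.  Width = length, height = λ₁ (0 for the empty board).
YoungBoard : List ℕ → Set
YoungBoard λs = Linked _≥_ λs × All (0 <_) λs

height : List ℕ → ℕ
height []      = 0
height (l ∷ _) = l

-- A filling word π₁⋯πₙ (no empty columns) is a standard filling of λ:
-- every column c holds exactly one 1, in a row 1 ≤ πc ≤ λc;
-- no row holds two 1s (entries distinct);
-- every row 1 ≤ r ≤ λ₁ of the board holds a 1.
IsStd : List ℕ → List ℕ → Set
IsStd λs π =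
  Pointwise (λ x l → 1 ≤ x × x ≤ l) π λs
  × Unique π
  × (∀ r → 1 ≤ r → r ≤ height λs → r ∈ π)

-- 0-based lookup with default 0
lookupD : List ℕ → ℕ → ℕ
lookupD []       _       = 0
lookupD (x ∷ _)  zero    = x
lookupD (_ ∷ xs) (suc i) = lookupD xs i

countBelow : List ℕ → ℕ → ℕ
countBelow R x = length (filter (_<? x) R)

countAtMost : List ℕ → ℕ → ℕ
countAtMost R x = length (filter (_≤? x) R)

-- ρ^{∅,R} on words: renumber the remaining rows after deleting rows R
reduceW : List ℕ → List ℕ → List ℕ
reduceW R w = map (λ x → x ∸ countBelow R x) w

-- μ^{(∅,R)}: delete rows R from the board μ (column heights shrink)
deleteRows : List ℕ → List ℕ → List ℕ
deleteRows R μ = map (λ c → c ∸ countAtMost R c) μ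

-- the y-th (1-based) positive integer not in R
liftRow : List ℕ → ℕ → ℕ
liftRow R y =
  lookupD (filter (λ x → ¬? (x ∈? R)) (map suc (upTo (y + length R)))) (y ∸ 1)

-- (ρ^{∅,R'})⁻¹ on words: reinsert the empty rows R'
unreduceW : List ℕ → List ℕ → List ℕ
unreduceW R w = map (liftRow R) w

splitAt1 : List ℕ → List ℕ × List ℕ
splitAt1 []            = [] , []
splitAt1 (1 ∷ xs)      = [] , xs
splitAt1 (x ∷ xs) with splitAt1 xs
... | (p , s) = (x ∷ p) , s

-- ζ with explicit fuel (recursion on the width; fuel = width suffices)
zetaF : ℕ → List ℕ → List ℕ → List ℕ
zetaF zero     λs π = π
zetaF (suc f)  λs []              = []
zetaF (suc f)  λs (x ∷ [])        = x ∷ []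
zetaF (suc f)  λs π@(_ ∷ _ ∷ _)   =
  let pre  = proj₁ (splitAt1 π)
      post = proj₂ (splitAt1 π)
      j-1  = length pre
      λj   = lookupD λs j-1
      μ    = take j-1 λs
      R    = 1 ∷ post
      μ'   = deleteRows R μ
      h'   = reduceW R pre
      h*   = zetaF f μ' h'
      R'   = λj ∷ map (_∸ 1) post
  in unreduceW R' h* ++ (λj ∷ map (_∸ 1) post)

zeta : List ℕ → List ℕ → List ℕ
zeta λs π = zetaF (length λs) λs π

module Submission where

-- A board carrying a standard filling is "balanced": its height equals its
-- width n, and a standard filling is then a word of distinct entries with
-- 1 ≤ π_c ≤ λ_c (every row is covered automatically, by pigeonhole).
-- Write π = pre · 1 · post and λ = μ · a · ν at the column of the 1.  Then
--   ζ(π) = lift_{R'}(ζ_{μ'}(reduce_R pre)) · a · (post − 1),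
-- with R = {1} ∪ post, R' = {a} ∪ (post − 1) and μ' = μ − |R|.

open import Defs
open import Data.Nat
open import Data.Nat.Properties
open import Data.List using (List; []; _∷_; length; filter; map; upTo; take; _++_; cartesianProductWith)
open import Data.List.Properties
  using (length-filter; filter-notAll; filter-accept; filter-reject; filter-all; filter-none; filter-++;
         length-map; length-upTo; length-++; length-++-sucʳ; upTo-∷ʳ; map-++; map-cong-local; ++-identityʳ;
         ∷-injective; ∷-injectiveˡ; ∷-injectiveʳ; ≡-dec)
open import Data.List.Relation.Unary.All as All using (All; []; _∷_)
open import Data.List.Relation.Unary.All.Properties using (All¬⇒¬Any)
import Data.List.Relation.Unary.All.Properties as AllProps
open import Data.List.Relation.Unary.Any as Any using (here; there)
open import Data.List.Relation.Unary.AllPairs using (AllPairs; []; _∷_)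
open import Data.List.Relation.Unary.Linked as Linked using (Linked; []; [-]; _∷_)
import Data.List.Relation.Unary.Linked.Properties as LinkedProps
open import Data.List.Relation.Unary.Unique.Propositional using (Unique)
import Data.List.Relation.Unary.Unique.Propositional.Properties as Unique
open import Data.List.Relation.Unary.Unique.DecPropositional _≟_ using (unique?)
open import Data.List.Relation.Binary.Pointwise as Pointwise using (Pointwise; []; _∷_; Pointwise-length)
open import Data.List.Relation.Binary.Subset.Propositional using (_⊆_)
open import Data.List.Relation.Binary.Disjoint.Propositional using (Disjoint)
open import Data.List.Membership.Propositional using (_∈_; _∉_)
open import Data.List.Membership.Propositional.Properties
  using (∈-filter⁺; ∈-filter⁻; ∈-map⁺; ∈-map⁻; ∈-upTo⁺; ∈-upTo⁻; ∈-++⁺ʳ; ∈-cartesianProductWith⁺)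
open import Data.List.Membership.DecPropositional _≟_ using (_∈?_)
open import Data.Product using (_×_; _,_; proj₁; proj₂; ∃)
open import Data.Sum using (inj₁; inj₂)
open import Data.Empty using (⊥; ⊥-elim)
open import Relation.Nullary using (yes; no; ¬?; Dec)
open import Relation.Nullary.Decidable using (_×-dec_)
open import Relation.Binary.Definitions using (DecidableEquality; tri<; tri≈; tri>)
open import Relation.Binary.PropositionalEquality
open import Function using (_∘_)

module _ {A B : Set} {P : A → Set} (f : A → B)
         (injective-on : ∀ {x y} → P x → P y → f x ≡ f y → x ≡ y) where

  unique-map-on : ∀ {xs} → All P xs → Unique xs → Unique (map f xs)
  unique-map-on []       []        = []
  unique-map-on (p ∷ ps) (x∉ ∷ u) = distinct ps x∉ ∷ unique-map-on ps u
    where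
    distinct : ∀ {ys} → All P ys → All (_ ≢_) ys → All (f _ ≢_) (map f ys)
    distinct []       []       = []
    distinct (q ∷ qs) (n ∷ ns) = (λ e → n (injective-on p q e)) ∷ distinct qs ns

  map-injective-on : ∀ {xs ys} → All P xs → All P ys → map f xs ≡ map f ys → xs ≡ ys
  map-injective-on []       []       _ = refl
  map-injective-on (p ∷ ps) (q ∷ qs) e =
    cong₂ _∷_ (injective-on p q (∷-injectiveˡ e)) (map-injective-on ps qs (∷-injectiveʳ e))

unique-++ˡ : ∀ {A : Set} (xs : List A) {ys} → Unique (xs ++ ys) → Unique xs
unique-++ˡ []       _        = []
unique-++ˡ (x ∷ xs) (a ∷ u) = AllProps.++⁻ˡ xs a ∷ unique-++ˡ xs u

unique-++ʳ : ∀ {A : Set} (xs : List A) {ys} → Unique (xs ++ ys) → Unique ys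
unique-++ʳ []       u        = u
unique-++ʳ (x ∷ xs) (_ ∷ u) = unique-++ʳ xs u

unique-disjoint : ∀ {A : Set} (xs : List A) {ys} → Unique (xs ++ ys) → All (_∉ ys) xs
unique-disjoint []       _        = []
unique-disjoint (x ∷ xs) (a ∷ u) = All¬⇒¬Any (AllProps.++⁻ʳ xs a) ∷ unique-disjoint xs u

++-injective-length : ∀ {A : Set} (xs₁ xs₂ : List A) {ys₁ ys₂} → length xs₁ ≡ length xs₂ →
  xs₁ ++ ys₁ ≡ xs₂ ++ ys₂ → xs₁ ≡ xs₂ × ys₁ ≡ ys₂
++-injective-length []         []         _   e = refl , e
++-injective-length (x₁ ∷ xs₁) (x₂ ∷ xs₂) len e with ∷-injective e
... | x₁≡x₂ , rest with ++-injective-length xs₁ xs₂ (suc-injective len) rest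
...   | xs₁≡xs₂ , ys₁≡ys₂ = cong₂ _∷_ x₁≡x₂ xs₁≡xs₂ , ys₁≡ys₂

module _ {R : ℕ → ℕ → Set} where

  pointwise-split : ∀ xs {ys cs} → Pointwise R (xs ++ ys) cs →
    ∃ λ cs₁ → ∃ λ cs₂ → cs ≡ cs₁ ++ cs₂ × Pointwise R xs cs₁ × Pointwise R ys cs₂
  pointwise-split []       rs       = [] , _ , refl , [] , rs
  pointwise-split (x ∷ xs) (r ∷ rs) with pointwise-split xs rs
  ... | cs₁ , cs₂ , refl , rs₁ , rs₂ = _ ∷ cs₁ , cs₂ , refl , r ∷ rs₁ , rs₂

  pointwise-allˡ : ∀ {P : ℕ → Set} → (∀ {x c} → R x c → P x) →
    ∀ {xs cs} → Pointwise R xs cs → All P xs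
  pointwise-allˡ h []       = []
  pointwise-allˡ h (r ∷ rs) = h r ∷ pointwise-allˡ h rs

  pointwise-withˡ : ∀ {P : ℕ → Set} {xs cs} → All P xs → Pointwise R xs cs →
    Pointwise (λ x c → P x × R x c) xs cs
  pointwise-withˡ []       []       = []
  pointwise-withˡ (p ∷ ps) (r ∷ rs) = (p , r) ∷ pointwise-withˡ ps rs

  pointwise-withʳ : ∀ {Q : ℕ → Set} {xs cs} → All Q cs → Pointwise R xs cs →
    Pointwise (λ x c → Q c × R x c) xs cs
  pointwise-withʳ []       []       = []
  pointwise-withʳ (q ∷ qs) (r ∷ rs) = (q , r) ∷ pointwise-withʳ qs rs

  pointwise-mapˡ : ∀ {S : ℕ → ℕ → Set} (f : ℕ → ℕ) → (∀ {x c} → R x c → S (f x) c) →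
    ∀ {xs cs} → Pointwise R xs cs → Pointwise S (map f xs) cs
  pointwise-mapˡ f h []       = []
  pointwise-mapˡ f h (r ∷ rs) = h r ∷ pointwise-mapˡ f h rs

  pointwise-unmapʳ : ∀ (g : ℕ → ℕ) {xs cs} → Pointwise R xs (map g cs) →
    Pointwise (λ x c → R x (g c)) xs cs
  pointwise-unmapʳ g {[]}    {[]}    []       = []
  pointwise-unmapʳ g {_ ∷ _} {_ ∷ _} (r ∷ rs) = r ∷ pointwise-unmapʳ g rs

-- The pigeonhole principle for lists over a type with decidable equality.

module Pigeonhole {A : Set} (_≟A_ : DecidableEquality A) where
  open import Data.List.Membership.DecPropositional _≟A_ using () renaming (_∈?_ to _∈A?_)

  private
    remove : A → List A → List A
    remove x = filter (λ y → ¬? (y ≟A x))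

    remove-shorter : ∀ {x ys} → x ∈ ys → length (remove x ys) < length ys
    remove-shorter {x} {ys} x∈ =
      filter-notAll (λ y → ¬? (y ≟A x)) ys (Any.map (λ x≡y y≢x → y≢x (sym x≡y)) x∈)

    remove-keeps : ∀ {x y ys} → y ∈ ys → y ≢ x → y ∈ remove x ys
    remove-keeps {x} y∈ y≢x = ∈-filter⁺ (λ y → ¬? (y ≟A x)) y∈ y≢x

  unique-⊆⇒≤ : ∀ {xs ys} → Unique xs → xs ⊆ ys → length xs ≤ length ys
  unique-⊆⇒≤ {[]}     _          _   = z≤n
  unique-⊆⇒≤ {x ∷ xs} {ys} (x∉ ∷ u) sub =
    ≤-trans (s≤s (unique-⊆⇒≤ u sub′)) (remove-shorter (sub (here refl)))
    where
    sub′ : xs ⊆ remove x ys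
    sub′ z∈ = remove-keeps (sub (there z∈)) (λ { refl → All¬⇒¬Any x∉ z∈ })

  unique-⊆-≥⇒⊇ : ∀ {xs ys} → Unique xs → xs ⊆ ys → length ys ≤ length xs → ys ⊆ xs
  unique-⊆-≥⇒⊇ {xs} {ys} u sub ≥ {y} y∈ with y ∈A? xs
  ... | yes y∈xs = y∈xs
  ... | no  y∉xs = ⊥-elim (<⇒≱ (≤-<-trans (unique-⊆⇒≤ u sub′) (remove-shorter y∈)) ≥)
    where
    sub′ : xs ⊆ remove y ys
    sub′ z∈ = remove-keeps (sub z∈) (λ { refl → y∉xs z∈ })

  injective⇒surjective : ∀ (xs : List A) → Unique xs → (g : A → A) →
    (∀ {x} → x ∈ xs → g x ∈ xs) →
    (∀ {x y} → x ∈ xs → y ∈ xs → g x ≡ g y → x ≡ y) →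
    ∀ {y} → y ∈ xs → ∃ λ x → x ∈ xs × g x ≡ y
  injective⇒surjective xs u g into injective y∈ with ∈-map⁻ g (image-full y∈)
    where
    image-full : xs ⊆ map g xs
    image-full = unique-⊆-≥⇒⊇ (unique-map-on g injective (All.tabulate (λ x∈ → x∈)) u)
      (λ z∈ → let (x , x∈ , z≡) = ∈-map⁻ g z∈ in subst (_∈ xs) (sym z≡) (into x∈))
      (≤-reflexive (sym (length-map g xs)))
  ... | x , x∈ , y≡ = x , x∈ , sym y≡

rows : ℕ → List ℕ
rows n = map suc (upTo n)

∈-rows : ∀ {n r} → 1 ≤ r → r ≤ n → r ∈ rows n
∈-rows {r = suc r} _ r≤n = ∈-map⁺ suc (∈-upTo⁺ r≤n)

rows-bounds : ∀ {n r} → r ∈ rows n → 1 ≤ r × r ≤ n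
rows-bounds r∈ with ∈-map⁻ suc r∈
... | _ , i∈ , refl = s≤s z≤n , ∈-upTo⁻ i∈

length-rows : ∀ n → length (rows n) ≡ n
length-rows n = trans (length-map suc (upTo n)) (length-upTo n)

rows-unique : ∀ n → Unique (rows n)
rows-unique n = Unique.map⁺ suc-injective (Unique.upTo⁺ n)

open Pigeonhole _≟_ using (unique-⊆⇒≤; unique-⊆-≥⇒⊇)

countBelow-zero : ∀ R → countBelow R 0 ≡ 0
countBelow-zero R = cong length (filter-none (_<? 0) {R} (All.tabulate (λ _ ())))

countBelow-all : ∀ R {M} → All (_< M) R → countBelow R M ≡ length R
countBelow-all R {M} R<M = cong length (filter-all (_<? M) R<M)

countBelow-≤ : ∀ {R} x → Unique R → countBelow R x ≤ x
countBelow-≤ {R} x u = subst (countBelow R x ≤_) (length-upTo x)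
  (unique-⊆⇒≤ (Unique.filter⁺ (_<? x) u)
    (λ r∈ → ∈-upTo⁺ (proj₂ (∈-filter⁻ (_<? x) {xs = R} r∈))))

countBelow-cons-≢ : ∀ {r x} R {c} → r ≢ x →
  countBelow R (suc x) ≡ c + countBelow R x →
  countBelow (r ∷ R) (suc x) ≡ c + countBelow (r ∷ R) x
countBelow-cons-≢ {r} {x} R {c} r≢x e with <-cmp r x
... | tri< r<x _ _
  rewrite filter-accept (_<? suc x) {r} {R} (m<n⇒m<1+n r<x) | filter-accept (_<? x) {r} {R} r<x
  = trans (cong suc e) (sym (+-suc c _))
... | tri≈ _ r≡x _ = ⊥-elim (r≢x r≡x)
... | tri> _ _ x<r
  rewrite filter-reject (_<? suc x) {r} {R} (λ r<1+x → <⇒≱ x<r (≤-pred r<1+x))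
        | filter-reject (_<? x) {r} {R} (<-asym x<r)
  = e

countBelow-suc-∉ : ∀ R {x} → x ∉ R → countBelow R (suc x) ≡ countBelow R x
countBelow-suc-∉ []      _  = refl
countBelow-suc-∉ (r ∷ R) x∉ =
  countBelow-cons-≢ R (λ { refl → x∉ (here refl) }) (countBelow-suc-∉ R (λ x∈ → x∉ (there x∈)))

countBelow-suc-∈ : ∀ {R x} → Unique R → x ∈ R → countBelow R (suc x) ≡ suc (countBelow R x)
countBelow-suc-∈ {x ∷ R} {x} (x∉ ∷ _) (here refl)
  rewrite filter-accept (_<? suc x) {x} {R} (n<1+n x) | filter-reject (_<? x) {x} {R} (n≮n x)
  = cong suc (countBelow-suc-∉ R (All¬⇒¬Any x∉))
countBelow-suc-∈ {r ∷ R} (r∉ ∷ u) (there x∈) =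
  countBelow-cons-≢ R (λ { refl → All¬⇒¬Any r∉ x∈ }) (countBelow-suc-∈ u x∈)

reduceRow : List ℕ → ℕ → ℕ
reduceRow R x = x ∸ countBelow R x

reduceRow-above : ∀ R {M} → All (_< M) R → reduceRow R M ≡ M ∸ length R
reduceRow-above R R<M = cong (_ ∸_) (countBelow-all R R<M)

module RowDeletion {R : List ℕ} (unique-R : Unique R) where

  reduceRow-suc-∈ : ∀ {x} → x ∈ R → reduceRow R (suc x) ≡ reduceRow R x
  reduceRow-suc-∈ x∈ = cong (suc _ ∸_) (countBelow-suc-∈ unique-R x∈)

  reduceRow-suc-∉ : ∀ {x} → x ∉ R → reduceRow R (suc x) ≡ suc (reduceRow R x)
  reduceRow-suc-∉ {x} x∉ =
    trans (cong (suc x ∸_) (countBelow-suc-∉ R x∉)) (+-∸-assoc 1 (countBelow-≤ x unique-R))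

  reduceRow-step : ∀ x → reduceRow R x ≤ reduceRow R (suc x)
  reduceRow-step x with x ∈? R
  ... | yes x∈ = ≤-reflexive (sym (reduceRow-suc-∈ x∈))
  ... | no  x∉ = subst (reduceRow R x ≤_) (sym (reduceRow-suc-∉ x∉)) (n≤1+n _)

  reduceRow-mono : ∀ {a} b → a ≤ b → reduceRow R a ≤ reduceRow R b
  reduceRow-mono zero    z≤n    = ≤-refl
  reduceRow-mono (suc b) a≤1+b with m≤n⇒m<n∨m≡n a≤1+b
  ... | inj₁ a<1+b = ≤-trans (reduceRow-mono b (≤-pred a<1+b)) (reduceRow-step b)
  ... | inj₂ refl  = ≤-refl

  reduceRow-strict : ∀ {a b} → a < b → a ∉ R → reduceRow R a < reduceRow R b
  reduceRow-strict {b = b} a<b a∉ =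
    subst (_≤ reduceRow R b) (reduceRow-suc-∉ a∉) (reduceRow-mono b a<b)

  reduceRow-injective : ∀ {a b} → a ∉ R → b ∉ R → reduceRow R a ≡ reduceRow R b → a ≡ b
  reduceRow-injective {a} {b} a∉ b∉ e with <-cmp a b
  ... | tri< a<b _ _ = ⊥-elim (<⇒≢ (reduceRow-strict a<b a∉) e)
  ... | tri≈ _ a≡b _ = a≡b
  ... | tri> _ _ b<a = ⊥-elim (<⇒≢ (reduceRow-strict b<a b∉) (sym e))

  reduceRow-lower : ∀ x → x ≤ reduceRow R x + length R
  reduceRow-lower x = begin
    x                                   ≡⟨ m∸n+n≡m (countBelow-≤ x unique-R) ⟨
    reduceRow R x + countBelow R x      ≤⟨ +-monoʳ-≤ (reduceRow R x) (length-filter (_<? x) R) ⟩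
    reduceRow R x + length R            ∎
    where open ≤-Reasoning

  module _ (0∉R : 0 ∉ R) where

    reduceRow-one : reduceRow R 1 ≡ 1
    reduceRow-one = cong (1 ∸_) (trans (countBelow-suc-∉ R 0∉R) (countBelow-zero R))

    reduceRow-pos : ∀ {x} → 1 ≤ x → 1 ≤ reduceRow R x
    reduceRow-pos {x} 1≤x = subst (_≤ reduceRow R x) reduceRow-one (reduceRow-mono x 1≤x)

-- Reinserting deleted rows.  keptRows R M lists the rows 1..M outside R in
-- increasing order, and liftRow R y is the y-th row outside R.

kept? : (R : List ℕ) → (x : ℕ) → Dec (x ∉ R)
kept? R x = ¬? (x ∈? R)

keptRows : List ℕ → ℕ → List ℕ
keptRows R M = filter (kept? R) (rows M)

keptRows-suc : ∀ R M → keptRows R (suc M) ≡ keptRows R M ++ filter (kept? R) (suc M ∷ [])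
keptRows-suc R M = begin
  filter (kept? R) (map suc (upTo (suc M)))       ≡⟨ cong (filter (kept? R) ∘ map suc) (upTo-∷ʳ M) ⟨
  filter (kept? R) (map suc (upTo M ++ M ∷ []))   ≡⟨ cong (filter (kept? R)) (map-++ suc (upTo M) (M ∷ [])) ⟩
  filter (kept? R) (rows M ++ suc M ∷ [])         ≡⟨ filter-++ (kept? R) (rows M) (suc M ∷ []) ⟩
  keptRows R M ++ filter (kept? R) (suc M ∷ [])   ∎
  where open ≡-Reasoning

keptRows-suc-∈ : ∀ {R M} → suc M ∈ R → keptRows R (suc M) ≡ keptRows R M
keptRows-suc-∈ {R} {M} M+1∈ = begin
  keptRows R (suc M)                              ≡⟨ keptRows-suc R M ⟩
  keptRows R M ++ filter (kept? R) (suc M ∷ [])   ≡⟨ cong (keptRows R M ++_) dropped ⟩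
  keptRows R M ++ []                              ≡⟨ ++-identityʳ (keptRows R M) ⟩
  keptRows R M                                    ∎
  where
  open ≡-Reasoning
  dropped : filter (kept? R) (suc M ∷ []) ≡ []
  dropped = filter-reject (kept? R) {xs = []} (λ M+1∉ → M+1∉ M+1∈)

keptRows-suc-∉ : ∀ {R M} → suc M ∉ R → keptRows R (suc M) ≡ keptRows R M ++ suc M ∷ []
keptRows-suc-∉ {R} {M} M+1∉ =
  trans (keptRows-suc R M) (cong (keptRows R M ++_) (filter-accept (kept? R) {xs = []} M+1∉))

length-snoc : ∀ (xs : List ℕ) y → length (xs ++ y ∷ []) ≡ suc (length xs)
length-snoc xs y = trans (length-++-sucʳ xs y []) (cong (suc ∘ length) (++-identityʳ xs))

lookupD-++ˡ : ∀ xs ys {i} → i < length xs → lookupD (xs ++ ys) i ≡ lookupD xs i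
lookupD-++ˡ (x ∷ xs) ys {zero}  _         = refl
lookupD-++ˡ (x ∷ xs) ys {suc i} (s≤s i<) = lookupD-++ˡ xs ys i<

lookupD-length : ∀ xs y ys → lookupD (xs ++ y ∷ ys) (length xs) ≡ y
lookupD-length []       y ys = refl
lookupD-length (x ∷ xs) y ys = lookupD-length xs y ys

Survivor : List ℕ → ℕ → ℕ → Set
Survivor R y x = 1 ≤ x × x ∉ R × reduceRow R x ≡ y

module Lifting {R : List ℕ} (unique-R : Unique R) (0∉R : 0 ∉ R) where
  open RowDeletion unique-R

  keptRows-length : ∀ M → suc (length (keptRows R M)) ≡ reduceRow R (suc M)
  keptRows-length zero = sym (reduceRow-one 0∉R)
  keptRows-length (suc M) with suc M ∈? R
  ... | yes M+1∈ rewrite keptRows-suc-∈ M+1∈ | reduceRow-suc-∈ M+1∈ = keptRows-length M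
  ... | no  M+1∉ rewrite keptRows-suc-∉ M+1∉ | reduceRow-suc-∉ M+1∉ =
    cong suc (trans (length-snoc (keptRows R M) (suc M)) (keptRows-length M))

  keptRows-lookup : ∀ M {i} → i < length (keptRows R M) → Survivor R (suc i) (lookupD (keptRows R M) i)
  keptRows-lookup zero    ()
  keptRows-lookup (suc M) {i} i< with suc M ∈? R
  ... | yes M+1∈ rewrite keptRows-suc-∈ M+1∈ = keptRows-lookup M i<
  ... | no  M+1∉ rewrite keptRows-suc-∉ M+1∉
    with m≤n⇒m<n∨m≡n (≤-pred (subst (i <_) (length-snoc (keptRows R M) (suc M)) i<))
  ...   | inj₁ i<len rewrite lookupD-++ˡ (keptRows R M) (suc M ∷ []) i<len = keptRows-lookup M i<len
  ...   | inj₂ refl  rewrite lookupD-length (keptRows R M) (suc M) [] =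
    s≤s z≤n , M+1∉ , sym (keptRows-length M)

  liftRow-section : ∀ {y} → 1 ≤ y → Survivor R y (liftRow R y)
  liftRow-section {suc y} _ =
    keptRows-lookup M (≤-pred (subst (suc (suc y) ≤_) (sym (keptRows-length M)) enough))
    where
    -- the bound used by liftRow: y + |R| rows contain y rows outside R
    M : ℕ
    M = suc y + length R
    enough : suc (suc y) ≤ reduceRow R (suc M)
    enough = +-cancelʳ-≤ (length R) _ _ (reduceRow-lower (suc M))

  liftRow-injective : ∀ {x y} → 1 ≤ x → 1 ≤ y → liftRow R x ≡ liftRow R y → x ≡ y
  liftRow-injective {x} {y} 1≤x 1≤y e = begin
    x                         ≡⟨ proj₂ (proj₂ (liftRow-section 1≤x)) ⟨
    reduceRow R (liftRow R x) ≡⟨ cong (reduceRow R) e ⟩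
    reduceRow R (liftRow R y) ≡⟨ proj₂ (proj₂ (liftRow-section 1≤y)) ⟩
    y                         ∎
    where open ≡-Reasoning

positive⇒0∉ : ∀ {xs} → All (1 ≤_) xs → 0 ∉ xs
positive⇒0∉ xs≥1 = All¬⇒¬Any (All.map (λ 1≤x → <⇒≢ 1≤x) xs≥1)

Fits : ℕ → ℕ → Set
Fits x l = 1 ≤ x × x ≤ l

-- every entry fits its column and no row is used twice; on a balanced board
-- this is the same as being standard (std⇒isStd, isStd⇒std)
Std : List ℕ → List ℕ → Set
Std λs π = Pointwise Fits π λs × Unique π

Balanced : List ℕ → Set
Balanced λs = Linked _≥_ λs × height λs ≡ length λs

decreasing⇒pairwise : ∀ {λs} → Linked _≥_ λs → AllPairs _≥_ λs
decreasing⇒pairwise = LinkedProps.Linked⇒AllPairs (λ x≥y y≥z → ≤-trans y≥z x≥y)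

height-bound : ∀ {λs} → Linked _≥_ λs → All (_≤ height λs) λs
height-bound {[]}     _ = []
height-bound {l ∷ λs} d with decreasing⇒pairwise d
... | l≥λs ∷ _ = ≤-refl ∷ l≥λs

decreasing-split : ∀ μ {a ν} → Linked _≥_ (μ ++ a ∷ ν) → All (a ≤_) μ × All (_≤ a) ν
decreasing-split μ d = split μ (decreasing⇒pairwise d)
  where
  split : ∀ μ {a ν} → AllPairs _≥_ (μ ++ a ∷ ν) → All (a ≤_) μ × All (_≤ a) ν
  split []      (a≥ν ∷ _)    = [] , a≥ν
  split (c ∷ μ) (c≥ ∷ rest) with split μ rest
  ... | a≤μ , ν≤a = All.lookup c≥ (∈-++⁺ʳ μ (here refl)) ∷ a≤μ , ν≤a

decreasing-prefix : ∀ μ {ys} → Linked _≥_ (μ ++ ys) → Linked _≥_ μ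
decreasing-prefix []          _       = []
decreasing-prefix (c ∷ [])    _       = [-]
decreasing-prefix (c ∷ d ∷ μ) (c≥d ∷ l) = c≥d ∷ decreasing-prefix (d ∷ μ) l

decreasing-lower : ∀ k {μ} → Linked _≥_ μ → Linked _≥_ (map (_∸ k) μ)
decreasing-lower k d = LinkedProps.map⁺ (Linked.map (∸-monoˡ-≤ k) d)

fits-rows : ∀ {λs π} → Linked _≥_ λs → Pointwise Fits π λs → π ⊆ rows (height λs)
fits-rows d fits = go fits (height-bound d)
  where
  go : ∀ {π λs h} → Pointwise Fits π λs → All (_≤ h) λs → π ⊆ rows h
  go ((1≤x , x≤l) ∷ _) (l≤h ∷ _)  (here refl) = ∈-rows 1≤x (≤-trans x≤l l≤h)
  go (_ ∷ fits)       (_ ∷ λs≤h) (there x∈)  = go fits λs≤h x∈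

-- by pigeonhole, a filling of a balanced board uses every row
std-covers : ∀ {λs π} → Balanced λs → Std λs π → rows (length λs) ⊆ π
std-covers {λs} {π} (d , h≡n) (fits , u) =
  unique-⊆-≥⇒⊇ u (subst (λ h → π ⊆ rows h) h≡n (fits-rows d fits))
    (≤-reflexive (trans (length-rows (length λs)) (sym (Pointwise-length fits))))

isStd⇒balanced : ∀ {λs π} → Linked _≥_ λs → IsStd λs π → Balanced λs
isStd⇒balanced {λs} {π} d (fits , u , covers) = d , ≤-antisym height≤width width≤height
  where
  height≤width : height λs ≤ length λs
  height≤width = subst₂ _≤_ (length-rows (height λs)) (Pointwise-length fits)
    (unique-⊆⇒≤ (rows-unique (height λs))
      (λ r∈ → let (1≤r , r≤h) = rows-bounds r∈ in covers _ 1≤r r≤h))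
  width≤height : length λs ≤ height λs
  width≤height = subst₂ _≤_ (Pointwise-length fits) (length-rows (height λs))
    (unique-⊆⇒≤ u (fits-rows d fits))

isStd⇒std : ∀ {λs π} → IsStd λs π → Std λs π
isStd⇒std (fits , u , _) = fits , u

std⇒isStd : ∀ {λs π} → Balanced λs → Std λs π → IsStd λs π
std⇒isStd b@(_ , h≡n) s@(fits , u) =
  fits , u , λ r 1≤r r≤h → std-covers b s (∈-rows 1≤r (subst (r ≤_) h≡n r≤h))

-- A filling pre · 1 · post of the board μ · a · ν is sent to
-- lift_{R'}(ζ_{μ'}(reduce_R pre)) · R', where R = {1} ∪ post are the rows of
-- the columns from the 1 on, R' = a · (post − 1) are the rows ζ puts there,
-- and μ' is μ with the rows R deleted.

emptiedRows : List ℕ → List ℕ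
emptiedRows post = 1 ∷ post

newRows : ℕ → List ℕ → List ℕ
newRows a post = a ∷ map (_∸ 1) post

innerZeta : ℕ → List ℕ → List ℕ → List ℕ → List ℕ
innerZeta f μ pre post = zetaF f (deleteRows (emptiedRows post) μ) (reduceW (emptiedRows post) pre)

zetaStep : ℕ → List ℕ → ℕ → List ℕ → List ℕ → List ℕ
zetaStep f μ a pre post = unreduceW (newRows a post) (innerZeta f μ pre post) ++ newRows a post

record StepData (μ : List ℕ) (a : ℕ) (ν pre post : List ℕ) : Set where
  field
    balanced  : Balanced (μ ++ a ∷ ν)
    pre-fits  : Pointwise Fits pre μ
    a-pos     : 1 ≤ a
    post-fits : Pointwise Fits post ν
    unique    : Unique (pre ++ 1 ∷ post)

∸1-injective : ∀ {x y} → 1 ≤ x → 1 ≤ y → x ∸ 1 ≡ y ∸ 1 → x ≡ y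
∸1-injective {suc x} {suc y} _ _ = cong suc

below-pred : ∀ {y n} → 1 ≤ y → y ≤ pred n → n ≤ y → ⊥
below-pred {n = zero}  1≤y y≤0 _   = <⇒≱ 1≤y y≤0
below-pred {n = suc n} _   y≤n n<y = <⇒≱ n<y y≤n

module Step {μ a ν pre post} (d : StepData μ a ν pre post) where
  open StepData d

  R R′ : List ℕ
  R  = emptiedRows post
  R′ = newRows a post

  p : ℕ
  p = length post

  a≤μ : All (a ≤_) μ
  a≤μ = proj₁ (decreasing-split μ (proj₁ balanced))

  ν≤a : All (_≤ a) ν
  ν≤a = proj₂ (decreasing-split μ (proj₁ balanced))

  -- the entries after the 1 lie in columns lower than a
  post≤a : All (_≤ a) post
  post≤a = pointwise-allˡ (λ (c≤a , _ , x≤c) → ≤-trans x≤c c≤a) (pointwise-withʳ ν≤a post-fits)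

  post-pos : All (1 ≤_) post
  post-pos = pointwise-allˡ proj₁ post-fits

  unique-R : Unique R
  unique-R = unique-++ʳ pre unique

  -- 1 occurs only in the column of the 1, so the later entries are at least 2
  post≥2 : All (2 ≤_) post
  post≥2 with unique-R
  ... | 1∉post ∷ _ = All.zipWith (λ (1≤x , 1≢x) → ≤∧≢⇒< 1≤x 1≢x) (post-pos , 1∉post)

  pre∉R : All (_∉ R) pre
  pre∉R = unique-disjoint pre unique

  open RowDeletion unique-R

  -- every row of R lies in the column a, hence in every column of μ
  R≤a : All (_≤ a) R
  R≤a = a-pos ∷ post≤a

  countAtMost-R : ∀ {c} → a ≤ c → countAtMost R c ≡ suc p
  countAtMost-R {c} a≤c = cong length (filter-all (_≤? c) (All.map (λ r≤a → ≤-trans r≤a a≤c) R≤a))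

  deleteRows-μ : deleteRows R μ ≡ map (_∸ suc p) μ
  deleteRows-μ = map-cong-local (All.map (λ {c} a≤c → cong (c ∸_) (countAtMost-R a≤c)) a≤μ)

  reduceRow-top : ∀ {c} → a ≤ c → reduceRow R (suc c) ≡ c ∸ p
  reduceRow-top a≤c = reduceRow-above R (All.map (λ r≤a → s≤s (≤-trans r≤a a≤c)) R≤a)

  reduced-balanced : Balanced (deleteRows R μ)
  reduced-balanced rewrite deleteRows-μ =
    decreasing-lower (suc p) (decreasing-prefix μ (proj₁ balanced)) , lowered-height μ (proj₂ balanced)
    where
    ν≡p : length ν ≡ p
    ν≡p = sym (Pointwise-length post-fits)
    lowered-height : ∀ μ → height (μ ++ a ∷ ν) ≡ length (μ ++ a ∷ ν) →
      height (map (_∸ suc p) μ) ≡ length (map (_∸ suc p) μ)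
    lowered-height []       _ = refl
    lowered-height (c ∷ μs) e = begin
      c ∸ suc p                                  ≡⟨ cong (_∸ suc p) e ⟩
      length (c ∷ μs ++ a ∷ ν) ∸ suc p           ≡⟨ cong (_∸ suc p) (length-++ (c ∷ μs)) ⟩
      suc (length μs) + suc (length ν) ∸ suc p   ≡⟨ cong (λ n → suc (length μs) + suc n ∸ suc p) ν≡p ⟩
      suc (length μs) + suc p ∸ suc p            ≡⟨ m+n∸n≡m (suc (length μs)) (suc p) ⟩
      suc (length μs)                            ≡⟨ cong suc (length-map (_∸ suc p) μs) ⟨
      length (map (_∸ suc p) (c ∷ μs))           ∎
      where open ≡-Reasoning

  reduce-fits : ∀ {x c} → x ∉ R → a ≤ c → Fits x c → Fits (reduceRow R x) (c ∸ suc p)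
  reduce-fits {x} {c} x∉ a≤c (1≤x , x≤c) =
    reduceRow-pos (positive⇒0∉ (s≤s z≤n ∷ post-pos)) 1≤x ,
    subst (reduceRow R x ≤_) (pred[m∸n]≡m∸[1+n] c p)
      (suc[m]≤n⇒m≤pred[n] (subst (reduceRow R x <_) (reduceRow-top a≤c) (reduceRow-strict (s≤s x≤c) x∉)))

  reduced-std : Std (deleteRows R μ) (reduceW R pre)
  reduced-std rewrite deleteRows-μ =
    Pointwise.map⁺ (reduceRow R) (_∸ suc p)
      (Pointwise.map (λ (x∉ , a≤c , fits) → reduce-fits x∉ a≤c fits)
        (pointwise-withˡ pre∉R (pointwise-withʳ a≤μ pre-fits))) ,
    unique-map-on (reduceRow R) reduceRow-injective pre∉R (unique-++ˡ pre unique)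

  R′≥1 : All (1 ≤_) R′
  R′≥1 = a-pos ∷ AllProps.map⁺ (All.map (λ { {suc x} (s≤s 1≤x) → 1≤x }) post≥2)

  R′≤a : All (_≤ a) R′
  R′≤a = ≤-refl ∷ AllProps.map⁺ (All.map (λ {x} x≤a → ≤-trans (m∸n≤m x 1) x≤a) post≤a)

  unique-R′ : Unique R′
  unique-R′ with unique-R
  ... | _ ∷ unique-post =
    AllProps.map⁺ (All.map a≢ (All.zip (post-pos , post≤a))) ∷
    unique-map-on (_∸ 1) ∸1-injective post-pos unique-post
    where
    a≢ : ∀ {x} → 1 ≤ x × x ≤ a → a ≢ x ∸ 1
    a≢ {suc x} (_ , x<a) a≡x = <⇒≢ x<a (sym a≡x)

  -- |R'| = |R|, so deleting R' also lowers the columns c ≥ a by p + 1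
  reduceRow′-top : ∀ {c} → a ≤ c → reduceRow R′ (suc c) ≡ c ∸ p
  reduceRow′-top {c} a≤c =
    trans (reduceRow-above R′ (All.map (λ r≤a → s≤s (≤-trans r≤a a≤c)) R′≤a))
          (cong (λ n → suc c ∸ suc n) (length-map (_∸ 1) post))

  module Deletion′ = RowDeletion unique-R′
  module Lifting′  = Lifting unique-R′ (positive⇒0∉ R′≥1)

  lift-fits : ∀ {y c} → a ≤ c → Fits y (c ∸ suc p) → Fits (liftRow R′ y) c
  lift-fits {y} {c} a≤c (1≤y , y≤) with Lifting′.liftRow-section 1≤y
  ... | 1≤x , _ , reduce-x≡y = 1≤x , ≮⇒≥ too-high
    where
    open ≤-Reasoning
    too-high : c < liftRow R′ y → ⊥
    too-high c<x = below-pred 1≤y (subst (y ≤_) (sym (pred[m∸n]≡m∸[1+n] c p)) y≤) (begin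
      c ∸ p                         ≡⟨ reduceRow′-top a≤c ⟨
      reduceRow R′ (suc c)          ≤⟨ Deletion′.reduceRow-mono _ c<x ⟩
      reduceRow R′ (liftRow R′ y)   ≡⟨ reduce-x≡y ⟩
      y                             ∎)

  lifted-std : ∀ {hs} → Std (deleteRows R μ) hs → Std (μ ++ a ∷ ν) (unreduceW R′ hs ++ R′)
  lifted-std {hs} (fits , u) =
    Pointwise.++⁺ lifted-fits ((a-pos , ≤-refl) ∷ tail-fits) , Unique.++⁺ lifted-unique unique-R′ disjoint
    where
    hs≥1 : All (1 ≤_) hs
    hs≥1 = pointwise-allˡ proj₁ fits
    lifted-fits : Pointwise Fits (unreduceW R′ hs) μ
    lifted-fits = pointwise-mapˡ (liftRow R′) (λ (a≤c , fits) → lift-fits a≤c fits)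
      (pointwise-withʳ a≤μ (pointwise-unmapʳ (_∸ suc p) (subst (Pointwise Fits hs) deleteRows-μ fits)))
    tail-fits : Pointwise Fits (map (_∸ 1) post) ν
    tail-fits = pointwise-mapˡ (_∸ 1) (λ { {suc x} (s≤s 1≤x , _ , x<c) → 1≤x , <⇒≤ x<c })
      (pointwise-withˡ post≥2 post-fits)
    lifted-unique : Unique (unreduceW R′ hs)
    lifted-unique = unique-map-on (liftRow R′) Lifting′.liftRow-injective hs≥1 u
    disjoint : Disjoint (unreduceW R′ hs) R′
    disjoint (v∈ , v∈R′) with ∈-map⁻ (liftRow R′) v∈
    ... | y , y∈ , refl = proj₁ (proj₂ (Lifting′.liftRow-section (All.lookup hs≥1 y∈))) v∈R′

  lifted-length : ∀ {hs} → Std (deleteRows R μ) hs → length (unreduceW R′ hs) ≡ length μ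
  lifted-length {hs} (fits , _) =
    trans (length-map (liftRow R′) hs) (trans (Pointwise-length fits) (length-map _ μ))

  tail-below : Pointwise _<_ (map (_∸ 1) post) ν
  tail-below = pointwise-mapˡ (_∸ 1) (λ { {suc x} (_ , x<c) → x<c }) post-fits

before1 : List ℕ → List ℕ
before1 π = proj₁ (splitAt1 π)

after1 : List ℕ → List ℕ
after1 π = proj₂ (splitAt1 π)

splitAt1-spec : ∀ π → 1 ∈ π → π ≡ before1 π ++ 1 ∷ after1 π
splitAt1-spec (suc zero ∷ xs)    _         = refl
splitAt1-spec (zero ∷ xs)        (there p) = cong (zero ∷_) (splitAt1-spec xs p)
splitAt1-spec (suc (suc x) ∷ xs) (there p) = cong (suc (suc x) ∷_) (splitAt1-spec xs p)

record Split (λs π : List ℕ) : Set where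
  constructor split
  field
    μ     : List ℕ
    a     : ℕ
    ν     : List ℕ
    board : λs ≡ μ ++ a ∷ ν
    word  : π ≡ before1 π ++ 1 ∷ after1 π
    step  : StepData μ a ν (before1 π) (after1 π)

split-std : ∀ {λs π} → Balanced λs → Std λs π → 1 ≤ length π → Split λs π
split-std {λs} {π} b (fits , u) 1≤n
  with splitAt1-spec π (std-covers b (fits , u) (∈-rows ≤-refl (subst (1 ≤_) (Pointwise-length fits) 1≤n)))
... | word with pointwise-split (before1 π) (subst (λ w → Pointwise Fits w λs) word fits)
...   | μ , a ∷ ν , refl , pre-fits , (_ , 1≤a) ∷ post-fits =
  split μ a ν refl word (record
    { balanced = b ; pre-fits = pre-fits ; a-pos = 1≤a ; post-fits = post-fits ; unique = subst Unique word u })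

-- zetaF extracts μ and a from the board by position
take-length-++ : ∀ (xs : List ℕ) {ys} → take (length xs) (xs ++ ys) ≡ xs
take-length-++ []       = refl
take-length-++ (x ∷ xs) = cong (x ∷_) (take-length-++ xs)

zetaF-split : ∀ f {λs x y r} (s : Split λs (x ∷ y ∷ r)) → let open Split s in
  zetaF (suc f) λs (x ∷ y ∷ r) ≡ zetaStep f μ a (before1 (x ∷ y ∷ r)) (after1 (x ∷ y ∷ r))
zetaF-split f (split μ a ν refl _ d)
  rewrite Pointwise-length (StepData.pre-fits d) | take-length-++ μ {a ∷ ν} | lookupD-length μ a ν = refl

Preserves : ℕ → Set
Preserves f = ∀ {λs π} → Balanced λs → Std λs π → Std λs (zetaF f λs π)

zetaF-preserves : ∀ f → Preserves f
zetaF-preserves zero    _ s = s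
zetaF-preserves (suc f) {π = []}        _ s = s
zetaF-preserves (suc f) {π = _ ∷ []}    _ s = s
zetaF-preserves (suc f) {λs} {x ∷ y ∷ r} b s =
  subst (Std λs) (sym (zetaF-split f sp)) (split-preserves sp)
  where
  sp : Split λs (x ∷ y ∷ r)
  sp = split-std b s (s≤s z≤n)
  split-preserves : ∀ {λs π} (sp : Split λs π) →
    Std λs (zetaStep f (Split.μ sp) (Split.a sp) (before1 π) (after1 π))
  split-preserves (split _ _ _ refl _ d) =
    Step.lifted-std d (zetaF-preserves f (Step.reduced-balanced d) (Step.reduced-std d))

full-not-below : ∀ (A μ : List ℕ) {a B ν} → length A ≡ length μ →
  Pointwise _<_ (A ++ a ∷ B) (μ ++ a ∷ ν) → ⊥
full-not-below []      []      _ (a<a ∷ _) = <-irrefl refl a<a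
full-not-below (_ ∷ A) (_ ∷ μ) l (_ ∷ b)   = full-not-below A μ (suc-injective l) b

-- In a word over a board, at most one column holds an entry equal to its
-- height while all later entries lie strictly below their columns.
last-full-column : ∀ (A₁ μ₁ A₂ μ₂ : List ℕ) {a₁ a₂ B₁ B₂ ν₁ ν₂} →
  length A₁ ≡ length μ₁ → length A₂ ≡ length μ₂ →
  A₁ ++ a₁ ∷ B₁ ≡ A₂ ++ a₂ ∷ B₂ → μ₁ ++ a₁ ∷ ν₁ ≡ μ₂ ++ a₂ ∷ ν₂ →
  Pointwise _<_ B₁ ν₁ → Pointwise _<_ B₂ ν₂ → length μ₁ ≡ length μ₂
last-full-column []        []        []        []        _ _ _    _    _ _ = refl
last-full-column []        []        (_ ∷ A₂)  (_ ∷ μ₂)  _ l refl refl b _ =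
  ⊥-elim (full-not-below A₂ μ₂ (suc-injective l) b)
last-full-column (_ ∷ A₁)  (_ ∷ μ₁)  []        []        l _ refl refl _ b =
  ⊥-elim (full-not-below A₁ μ₁ (suc-injective l) b)
last-full-column (_ ∷ A₁)  (_ ∷ μ₁)  (_ ∷ A₂)  (_ ∷ μ₂)  l₁ l₂ eA eμ b₁ b₂ =
  cong suc (last-full-column A₁ μ₁ A₂ μ₂ (suc-injective l₁) (suc-injective l₂) (∷-injectiveʳ eA) (∷-injectiveʳ eμ) b₁ b₂)

Injective : ℕ → Set
Injective f = ∀ {λs π σ} → Balanced λs → Std λs π → Std λs σ → zetaF f λs π ≡ zetaF f λs σ → π ≡ σ

module StepInjective (f : ℕ) (preserves : Preserves f) (injective : Injective f) where

  inner-std : ∀ {μ a ν pre post} → StepData μ a ν pre post →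
    Std (deleteRows (emptiedRows post) μ) (innerZeta f μ pre post)
  inner-std d = preserves (Step.reduced-balanced d) (Step.reduced-std d)

  output-parts : ∀ {μ a ν pre₁ post₁ pre₂ post₂} →
    StepData μ a ν pre₁ post₁ → StepData μ a ν pre₂ post₂ →
    zetaStep f μ a pre₁ post₁ ≡ zetaStep f μ a pre₂ post₂ →
    unreduceW (newRows a post₁) (innerZeta f μ pre₁ post₁) ≡ unreduceW (newRows a post₂) (innerZeta f μ pre₂ post₂)
    × newRows a post₁ ≡ newRows a post₂
  output-parts d₁ d₂ = ++-injective-length _ _
    (trans (Step.lifted-length d₁ (inner-std d₁)) (sym (Step.lifted-length d₂ (inner-std d₂))))

  output-post : ∀ {μ a ν pre₁ post₁ pre₂ post₂}
    (d₁ : StepData μ a ν pre₁ post₁) (d₂ : StepData μ a ν pre₂ post₂) →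
    zetaStep f μ a pre₁ post₁ ≡ zetaStep f μ a pre₂ post₂ → post₁ ≡ post₂
  output-post d₁ d₂ e = map-injective-on (_∸ 1) ∸1-injective (Step.post-pos d₁) (Step.post-pos d₂)
    (∷-injectiveʳ (proj₂ (output-parts d₁ d₂ e)))

  -- with post known, undoing the lift, then ζ_{μ'}, then the reduction recovers pre
  output-pre : ∀ {μ a ν pre₁ pre₂ post}
    (d₁ : StepData μ a ν pre₁ post) (d₂ : StepData μ a ν pre₂ post) →
    zetaStep f μ a pre₁ post ≡ zetaStep f μ a pre₂ post → pre₁ ≡ pre₂
  output-pre d₁ d₂ e =
    map-injective-on (reduceRow S₁.R) (RowDeletion.reduceRow-injective S₁.unique-R) S₁.pre∉R S₂.pre∉R
      (injective S₁.reduced-balanced S₁.reduced-std S₂.reduced-std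
        (map-injective-on (liftRow S₁.R′) S₁.Lifting′.liftRow-injective
          (pointwise-allˡ proj₁ (proj₁ (inner-std d₁))) (pointwise-allˡ proj₁ (proj₁ (inner-std d₂)))
          (proj₁ (output-parts d₁ d₂ e))))
    where
    module S₁ = Step d₁
    module S₂ = Step d₂

  zetaStep-injective : ∀ {μ a ν pre₁ post₁ pre₂ post₂}
    (d₁ : StepData μ a ν pre₁ post₁) (d₂ : StepData μ a ν pre₂ post₂) →
    zetaStep f μ a pre₁ post₁ ≡ zetaStep f μ a pre₂ post₂ → pre₁ ++ 1 ∷ post₁ ≡ pre₂ ++ 1 ∷ post₂
  zetaStep-injective d₁ d₂ e with output-post d₁ d₂ e
  ... | refl = cong (_++ 1 ∷ _) (output-pre d₁ d₂ e)

  -- the column of the 1 is the last column of the output holding its height,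
  -- so fillings with equal images are split at the same column
  split-injective : ∀ {λs π σ} (sπ : Split λs π) (sσ : Split λs σ) →
    zetaStep f (Split.μ sπ) (Split.a sπ) (before1 π) (after1 π) ≡
    zetaStep f (Split.μ sσ) (Split.a sσ) (before1 σ) (after1 σ) → π ≡ σ
  split-injective (split μ₁ a₁ ν₁ refl w₁ d₁) (split μ₂ a₂ ν₂ b₂ w₂ d₂) e
    with ++-injective-length μ₁ μ₂
           (last-full-column _ μ₁ _ μ₂ (Step.lifted-length d₁ (inner-std d₁)) (Step.lifted-length d₂ (inner-std d₂))
              e b₂ (Step.tail-below d₁) (Step.tail-below d₂))
           b₂
  ... | refl , refl = trans w₁ (trans (zetaStep-injective d₁ d₂ e) (sym w₂))

zetaF-injective : ∀ f → Injective f
zetaF-injective zero    _ _ _ e = e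
zetaF-injective (suc f) {[]}        _ ([] , _)          ([] , _)          _ = refl
zetaF-injective (suc f) {_ ∷ []}    _ ((_ ∷ []) , _)    ((_ ∷ []) , _)    e = e
zetaF-injective (suc f) {λs} {π} {σ} b s@((_ ∷ _ ∷ _) , _) t@((_ ∷ _ ∷ _) , _) e =
  StepInjective.split-injective f (zetaF-preserves f) (zetaF-injective f) sπ sσ
    (trans (sym (zetaF-split f sπ)) (trans e (zetaF-split f sσ)))
  where
  sπ : Split λs π
  sπ = split-std b s (s≤s z≤n)
  sσ : Split λs σ
  sσ = split-std b t (s≤s z≤n)

-- The finite set of standard fillings, and surjectivity by counting.

words : ℕ → List ℕ → List (List ℕ)
words zero    as = [] ∷ []
words (suc n) as = cartesianProductWith _∷_ as (words n as)

words-complete : ∀ {as} π → All (_∈ as) π → π ∈ words (length π) as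
words-complete []      []         = here refl
words-complete (x ∷ π) (x∈ ∷ π∈) = ∈-cartesianProductWith⁺ _∷_ x∈ (words-complete π π∈)

words-unique : ∀ n {as} → Unique as → Unique (words n as)
words-unique zero    _ = [] ∷ []
words-unique (suc n) u = Unique.cartesianProductWith⁺ _∷_ ∷-injective u (words-unique n u)

std? : ∀ λs π → Dec (Std λs π)
std? λs π = Pointwise.decidable (λ x l → (1 ≤? x) ×-dec (x ≤? l)) π λs ×-dec unique? π

-- every standard filling of a balanced board of width n is a word of length
-- n over the rows 1..n
stdFillings : List ℕ → List (List ℕ)
stdFillings λs = filter (std? λs) (words (length λs) (rows (length λs)))

stdFillings-complete : ∀ {λs π} → Balanced λs → Std λs π → π ∈ stdFillings λs
stdFillings-complete {λs} {π} (d , h≡n) s@(fits , _) = ∈-filter⁺ (std? λs)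
  (subst (λ m → π ∈ words m (rows (length λs))) (Pointwise-length fits)
    (words-complete π (All.tabulate (subst (λ h → π ⊆ rows h) h≡n (fits-rows d fits))))) s

stdFillings-sound : ∀ {λs π} → π ∈ stdFillings λs → Std λs π
stdFillings-sound {λs} π∈ = proj₂ (∈-filter⁻ (std? λs) {xs = words (length λs) (rows (length λs))} π∈)

stdFillings-unique : ∀ λs → Unique (stdFillings λs)
stdFillings-unique λs = Unique.filter⁺ (std? λs) (words-unique (length λs) (rows-unique (length λs)))

zetaF-surjective : ∀ f {λs σ} → Balanced λs → Std λs σ → ∃ λ π → Std λs π × zetaF f λs π ≡ σ
zetaF-surjective f {λs} b t
  with Pigeonhole.injective⇒surjective (≡-dec _≟_) (stdFillings λs) (stdFillings-unique λs) (zetaF f λs)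
         (λ π∈ → stdFillings-complete b (zetaF-preserves f b (stdFillings-sound π∈)))
         (λ π∈ σ∈ → zetaF-injective f b (stdFillings-sound π∈) (stdFillings-sound σ∈))
         (stdFillings-complete b t)
... | π , π∈ , ζπ≡σ = π , stdFillings-sound π∈ , ζπ≡σ

lemma3p12 : (λs : List ℕ) → YoungBoard λs →
    (∀ π → IsStd λs π → IsStd λs (zeta λs π))
    × (∀ π σ → IsStd λs π → IsStd λs σ → zeta λs π ≡ zeta λs σ → π ≡ σ)
    × (∀ σ → IsStd λs σ → ∃ λ π → IsStd λs π × zeta λs π ≡ σ)
lemma3p12 λs (decreasing , _) = preserves , injective , surjective
  where
  balanced : ∀ {π} → IsStd λs π → Balanced λs
  balanced = isStd⇒balanced decreasing

  preserves : ∀ π → IsStd λs π → IsStd λs (zeta λs π)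
  preserves π s = std⇒isStd (balanced s) (zetaF-preserves (length λs) (balanced s) (isStd⇒std s))

  injective : ∀ π σ → IsStd λs π → IsStd λs σ → zeta λs π ≡ zeta λs σ → π ≡ σ
  injective π σ s t = zetaF-injective (length λs) (balanced s) (isStd⇒std s) (isStd⇒std t)

  surjective : ∀ σ → IsStd λs σ → ∃ λ π → IsStd λs π × zeta λs π ≡ σ
  surjective σ t with zetaF-surjective (length λs) (balanced t) (isStd⇒std t)
  ... | π , s , ζπ≡σ = π , std⇒isStd (balanced t) s , ζπ≡σ
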